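{- Let $F$ be a field, let $B \in F^{n\times n}$ be symmetric, let $\operatorname{qpr}(B)=q_1 q_2 \cdots q_n$, and let $B[\gamma]$ be a nonsingular principal submatrix of $B$ with $|\gamma| = k \leq \operatorname{rank} B$. Let $C = B/B[\gamma]$ be the Schur complement of $B[\gamma]$ in $B$, and let $\operatorname{qpr}(C)=q'_{1} q'_2 \cdots q'_{n-k}$. Then, for $j=1, \dots, n-k$, $q'_j=q_{j+k}$ whenever $q_{j+k} \in \{{\tt A},{\tt N}\}$.
   Context: For an $n\times n$ matrix $B$ and $\alpha,\beta\subseteq\{1,\dots,n\}$, $B[\alpha,\beta]$ denotes the submatrix with rows indexed by $\alpha$ and columns indexed by $\beta$, and $B[\gamma]=B[\gamma,\gamma]$. $B[\alpha,\beta]$ is a quasi-principal submatrix if $|\alpha|=|\beta|$ and $|\alpha|-1\le|\alpha\cap\beta|\le|\alpha|$; its determinant is then a quasi-principal minor of order $|\alpha|$. The quasi principal rank characteristic sequence of a symmetric $B\in F^{n\times n}$ is $\operatorname{qpr}(B)=q_1q_2\cdots q_n$, where $q_k={\tt A}$ if all quasi-principal minors of order $k$ are nonzero, $q_k={\tt S}$ if some but not all are nonzero, and $q_k={\tt N}$ if all are zero. The Schur complement $B/B[\gamma]$ is the symmetric $(n-k)\times(n-k)$ matrix $B[\bar\gamma]-B[\bar\gamma,\gamma]B[\gamma]^{ -1}B[\gamma,\bar\gamma]$, where $\bar\gamma$ is the complement of $\gamma$. -}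

module Defs where

open import Level using (Level; _⊔_) renaming (suc to lsuc)
open import Algebra.Bundles using (CommutativeRing)
open import Data.Nat using (ℕ; zero; suc; _≤_)
open import Data.Bool using (Bool; true; false)
open import Data.Fin using (Fin; zero; suc; punchIn; cast)
open import Data.Vec using (Vec; []; _∷_)
open import Data.Product using (Σ; ∃; _×_; _,_)
open import Relation.Nullary using (¬_)
open import Relation.Binary.PropositionalEquality using (_≡_; sym)

record Field (c ℓ : Level) : Set (lsuc (c ⊔ ℓ)) where
  field
    commutativeRing : CommutativeRing c ℓ
  open CommutativeRing commutativeRing public
  field
    1≉0     : ¬ (1# ≈ 0#)
    inverse : ∀ x → ¬ (x ≈ 0#) → Σ Carrier (λ y → x * y ≈ 1#)

Subset : ℕ → Set
Subset n = Vec Bool n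

card : ∀ {n} → Subset n → ℕ
card []          = zero
card (true ∷ p)  = suc (card p)
card (false ∷ p) = card p

compl : ∀ {n} → Subset n → Subset n
compl []          = []
compl (true ∷ p)  = false ∷ compl p
compl (false ∷ p) = true ∷ compl p

_∩_ : ∀ {n} → Subset n → Subset n → Subset n
[] ∩ []                  = []
(true ∷ p) ∩ (true ∷ q)  = true ∷ (p ∩ q)
(true ∷ p) ∩ (false ∷ q) = false ∷ (p ∩ q)
(false ∷ p) ∩ (_ ∷ q)    = false ∷ (p ∩ q)

elems : ∀ {n} (p : Subset n) → Fin (card p) → Fin n
elems (true ∷ p)  zero    = zero
elems (true ∷ p)  (suc i) = suc (elems p i)
elems (false ∷ p) i       = suc (elems p i)

data QPRLetter : Set where
  A S N : QPRLetter

module _ {c ℓ : Level} (F : Field c ℓ) where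
  open Field F using (Carrier; _≈_; _+_; _*_; -_; _-_; 0#; 1#)

  Matrix : ℕ → ℕ → Set c
  Matrix m n = Fin m → Fin n → Carrier

  sumF : ∀ {n} → (Fin n → Carrier) → Carrier
  sumF {zero}  f = 0#
  sumF {suc n} f = f zero + sumF (λ i → f (suc i))

  sgn : ℕ → Carrier
  sgn zero    = 1#
  sgn (suc k) = - sgn k

  toN : ∀ {n} → Fin n → ℕ
  toN zero    = zero
  toN (suc i) = suc (toN i)

  det : ∀ {n} → Matrix n n → Carrier
  det {zero}  M = 1#
  det {suc n} M =
    sumF (λ i → sgn (toN i) * (M i zero * det (λ a b → M (punchIn i a) (suc b))))

  _·_ : ∀ {m k n} → Matrix m k → Matrix k n → Matrix m n
  (M · P) i j = sumF (λ l → M i l * P l j)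

  identity : ∀ {n} → Matrix n n
  identity zero    zero    = 1#
  identity zero    (suc j) = 0#
  identity (suc i) zero    = 0#
  identity (suc i) (suc j) = identity i j

  _≈M_ : ∀ {m n} → Matrix m n → Matrix m n → Set ℓ
  M ≈M P = ∀ i j → M i j ≈ P i j

  Symmetric : ∀ {n} → Matrix n n → Set ℓ
  Symmetric B = ∀ i j → B i j ≈ B j i

  sub : ∀ {n} → Matrix n n → (α β : Subset n) → Matrix (card α) (card β)
  sub B α β i j = B (elems α i) (elems β j)

  prin : ∀ {n} → Matrix n n → (γ : Subset n) → Matrix (card γ) (card γ)
  prin B γ = sub B γ γ

  Nonsingular : ∀ {n} → Matrix n n → Set ℓ
  Nonsingular M = ¬ (det M ≈ 0#)

  minor : ∀ {n} → Matrix n n → (m : ℕ) → (α β : Subset n) →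
          card α ≡ m → card β ≡ m → Carrier
  minor B m α β eα eβ =
    det (λ (i j : Fin m) → B (elems α (cast (sym eα) i)) (elems β (cast (sym eβ) j)))

  RankAtLeast : ∀ {n} → Matrix n n → ℕ → Set ℓ
  RankAtLeast B k = Σ (Subset _) λ α → Σ (Subset _) λ β →
    Σ (card α ≡ k) λ eα → Σ (card β ≡ k) λ eβ → ¬ (minor B k α β eα eβ ≈ 0#)

  -- B[α,β] is quasi-principal of order m: |α| = |β| = m and |α ∩ β| ≥ m - 1
  -- (|α ∩ β| ≤ m is automatic)
  QuasiPrincipal : ∀ {n} → ℕ → Subset n → Subset n → Set
  QuasiPrincipal m α β = m ≤ suc (card (α ∩ β))

  QPRAt : ∀ {n} → Matrix n n → ℕ → QPRLetter → Set ℓ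
  QPRAt B m A = ∀ α β (eα : card α ≡ m) (eβ : card β ≡ m) →
    QuasiPrincipal m α β → ¬ (minor B m α β eα eβ ≈ 0#)
  QPRAt B m N = ∀ α β (eα : card α ≡ m) (eβ : card β ≡ m) →
    QuasiPrincipal m α β → minor B m α β eα eβ ≈ 0#
  QPRAt B m S =
    (Σ (Subset _) λ α → Σ (Subset _) λ β → Σ (card α ≡ m) λ eα → Σ (card β ≡ m) λ eβ →
       QuasiPrincipal m α β × ¬ (minor B m α β eα eβ ≈ 0#)) ×
    (Σ (Subset _) λ α → Σ (Subset _) λ β → Σ (card α ≡ m) λ eα → Σ (card β ≡ m) λ eβ →
       QuasiPrincipal m α β × (minor B m α β eα eβ ≈ 0#))

  IsInverse : ∀ {n} → Matrix n n → Matrix n n → Set ℓ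
  IsInverse M X = ((M · X) ≈M identity) × ((X · M) ≈M identity)

  -- Schur complement B/B[γ] = B[γ̄] − B[γ̄,γ] B[γ]⁻¹ B[γ,γ̄], where X = B[γ]⁻¹
  schur : ∀ {n} → Matrix n n → (γ : Subset n) → Matrix (card γ) (card γ) →
          Matrix (card (compl γ)) (card (compl γ))
  schur B γ X i j =
    sub B (compl γ) (compl γ) i j - ((sub B (compl γ) γ · X) · sub B γ (compl γ)) i j

module Submission where

-- Let C = B/B[γ] with |γ| = k. For α, β ⊆ γ̄ with |α| = |β| = j let α ∪ γ, β ∪ γ be the
-- corresponding subsets of {1,…,n} ('adjoin'). Schur's determinant formula
--     det B[α ∪ γ, β ∪ γ] = ± det C[α,β] · det B[γ]
-- together with (α ∪ γ) ∩ (β ∪ γ) = (α ∩ β) ∪ γ shows that the quasi-principal minors of C of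
-- order j are, up to the nonzero factor ± det B[γ], quasi-principal minors of B of order j + k.
-- Hence "all nonzero" (A) and "all zero" (N) pass from q_{j+k} to q′_j.

open import Algebra.Bundles using (CommutativeRing)
open import Defs using (Field)

module Subsets where

  open import Defs using (Subset; card; compl; _∩_; elems)
  open import Data.Nat using (zero; suc; _+_; _≤_)
  open import Data.Nat.Properties using (+-suc; +-monoˡ-≤)
  open import Data.Bool using (Bool; true; false; not)
  open import Data.Fin using (Fin; zero; suc)
  open import Data.Vec using ([]; _∷_; lookup)
  open import Data.List using (List; []; _∷_; _++_; map; tabulate; length; filterᵇ)
  open import Data.List.Properties using (map-++; map-∘; map-tabulate; length-tabulate)
  open import Data.List.Relation.Binary.Permutation.Propositional using (_↭_; ↭-refl; module PermutationReasoning)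
  open import Data.List.Relation.Binary.Permutation.Propositional.Properties using (shift; map⁺)
  open import Data.Product using (Σ; _,_)
  open import Function using (_∘_)
  open import Relation.Binary.PropositionalEquality using (_≡_; refl; cong; sym; trans)
  open PermutationReasoning

  filterᵇ-map : ∀ {I J : Set} (P : J → Bool) (f : I → J) xs →
                filterᵇ P (map f xs) ≡ map f (filterᵇ (P ∘ f) xs)
  filterᵇ-map P f [] = refl
  filterᵇ-map P f (x ∷ xs) with P (f x)
  ... | true  = cong (f x ∷_) (filterᵇ-map P f xs)
  ... | false = filterᵇ-map P f xs

  elements : ∀ {n} → Subset n → List (Fin n)
  elements []          = []
  elements (true ∷ p)  = zero ∷ map suc (elements p)
  elements (false ∷ p) = map suc (elements p)

  elements≡tabulate : ∀ {n} (p : Subset n) → elements p ≡ tabulate (elems p)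
  elements≡tabulate []          = refl
  elements≡tabulate (true ∷ p)  =
    cong (zero ∷_) (trans (cong (map suc) (elements≡tabulate p)) (map-tabulate (elems p) suc))
  elements≡tabulate (false ∷ p) =
    trans (cong (map suc) (elements≡tabulate p)) (map-tabulate (elems p) suc)

  length-elements : ∀ {n} (p : Subset n) → length (elements p) ≡ card p
  length-elements p = trans (cong length (elements≡tabulate p)) (length-tabulate (elems p))

  ∉compl⇒∈ : ∀ {n} (γ : Subset n) x → lookup (compl γ) x ≡ false →
             Σ (Fin (card γ)) λ g → elems γ g ≡ x
  ∉compl⇒∈ (true ∷ γ)  zero    _ = zero , refl
  ∉compl⇒∈ (true ∷ γ)  (suc x) e with ∉compl⇒∈ γ x e
  ... | g , refl = suc g , refl
  ∉compl⇒∈ (false ∷ γ) (suc x) e with ∉compl⇒∈ γ x e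
  ... | g , refl = g , refl

  -- adjoin γ q is γ together with the subset q of the complement of γ,
  -- the latter transported to a subset of {1,…,n}.
  adjoin : ∀ {n} (γ : Subset n) → Subset (card (compl γ)) → Subset n
  adjoin []          []      = []
  adjoin (true ∷ γ)  q       = true ∷ adjoin γ q
  adjoin (false ∷ γ) (b ∷ q) = b ∷ adjoin γ q

  card-adjoin : ∀ {n} (γ : Subset n) q → card (adjoin γ q) ≡ card q + card γ
  card-adjoin []          []          = refl
  card-adjoin (true ∷ γ)  q           = trans (cong suc (card-adjoin γ q)) (sym (+-suc (card q) (card γ)))
  card-adjoin (false ∷ γ) (true ∷ q)  = cong suc (card-adjoin γ q)
  card-adjoin (false ∷ γ) (false ∷ q) = card-adjoin γ q

  adjoin-card : ∀ {n} (γ : Subset n) q {j} → card q ≡ j → card (adjoin γ q) ≡ j + card γ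
  adjoin-card γ q e = trans (card-adjoin γ q) (cong (_+ card γ) e)

  adjoin-∩ : ∀ {n} (γ : Subset n) a b → adjoin γ a ∩ adjoin γ b ≡ adjoin γ (a ∩ b)
  adjoin-∩ []          []          []          = refl
  adjoin-∩ (true ∷ γ)  a           b           = cong (true ∷_) (adjoin-∩ γ a b)
  adjoin-∩ (false ∷ γ) (true ∷ a)  (true ∷ b)  = cong (true ∷_) (adjoin-∩ γ a b)
  adjoin-∩ (false ∷ γ) (true ∷ a)  (false ∷ b) = cong (false ∷_) (adjoin-∩ γ a b)
  adjoin-∩ (false ∷ γ) (false ∷ a) (_ ∷ b)     = cong (false ∷_) (adjoin-∩ γ a b)

  quasiPrincipal-adjoin : ∀ {n} (γ : Subset n) a b j → j ≤ suc (card (a ∩ b)) →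
                          j + card γ ≤ suc (card (adjoin γ a ∩ adjoin γ b))
  quasiPrincipal-adjoin γ a b j le rewrite adjoin-∩ γ a b | card-adjoin γ (a ∩ b) =
    +-monoˡ-≤ (card γ) le

  private
    enum-skip : ∀ {n} (γ : Subset n) xs →
                map (elems (compl (true ∷ γ))) xs ≡ map suc (map (elems (compl γ)) xs)
    enum-skip γ xs = map-∘ xs

    enum-shift : ∀ {n} (γ : Subset n) xs →
                 map (elems (compl (false ∷ γ))) (map suc xs) ≡ map suc (map (elems (compl γ)) xs)
    enum-shift γ xs = trans (sym (map-∘ xs)) (map-∘ xs)

  elements-adjoin-↭ : ∀ {n} (γ : Subset n) q →
    elements (adjoin γ q) ↭ map (elems (compl γ)) (elements q) ++ elements γ
  elements-adjoin-↭ []          []          = ↭-refl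
  elements-adjoin-↭ (true ∷ γ)  q           = begin
    zero ∷ map suc (elements (adjoin γ q))    <⟨ map⁺ suc (elements-adjoin-↭ γ q) ⟩
    zero ∷ map suc (Q ++ elements γ)          ≡⟨ cong (zero ∷_) (map-++ suc Q (elements γ)) ⟩
    zero ∷ map suc Q ++ map suc (elements γ)  ↭⟨ shift zero (map suc Q) (map suc (elements γ)) ⟨
    map suc Q ++ zero ∷ map suc (elements γ)  ≡⟨ cong (_++ elements (true ∷ γ)) (enum-skip γ (elements q)) ⟨
    map (elems (compl (true ∷ γ))) (elements q) ++ elements (true ∷ γ) ∎
    where Q = map (elems (compl γ)) (elements q)
  elements-adjoin-↭ (false ∷ γ) (true ∷ q)  = begin
    zero ∷ map suc (elements (adjoin γ q))    <⟨ map⁺ suc (elements-adjoin-↭ γ q) ⟩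
    zero ∷ map suc (Q ++ elements γ)          ≡⟨ cong (zero ∷_) (map-++ suc Q (elements γ)) ⟩
    zero ∷ map suc Q ++ map suc (elements γ)  ≡⟨ cong (λ xs → zero ∷ xs ++ elements (false ∷ γ)) (enum-shift γ (elements q)) ⟨
    map (elems (compl (false ∷ γ))) (elements (true ∷ q)) ++ elements (false ∷ γ) ∎
    where Q = map (elems (compl γ)) (elements q)
  elements-adjoin-↭ (false ∷ γ) (false ∷ q) = begin
    map suc (elements (adjoin γ q))           ↭⟨ map⁺ suc (elements-adjoin-↭ γ q) ⟩
    map suc (Q ++ elements γ)                 ≡⟨ map-++ suc Q (elements γ) ⟩
    map suc Q ++ map suc (elements γ)         ≡⟨ cong (_++ elements (false ∷ γ)) (enum-shift γ (elements q)) ⟨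
    map (elems (compl (false ∷ γ))) (elements (false ∷ q)) ++ elements (false ∷ γ) ∎
    where Q = map (elems (compl γ)) (elements q)

  filter-adjoin : ∀ {n} (γ : Subset n) q →
    filterᵇ (lookup (compl γ)) (elements (adjoin γ q)) ≡ map (elems (compl γ)) (elements q)
  filter-adjoin []          []          = refl
  filter-adjoin (true ∷ γ)  q           =
    trans (filterᵇ-map (lookup (false ∷ compl γ)) suc (elements (adjoin γ q)))
          (trans (cong (map suc) (filter-adjoin γ q)) (sym (enum-skip γ (elements q))))
  filter-adjoin (false ∷ γ) (true ∷ q)  = cong (zero ∷_)
    (trans (filterᵇ-map (lookup (true ∷ compl γ)) suc (elements (adjoin γ q)))
           (trans (cong (map suc) (filter-adjoin γ q)) (sym (enum-shift γ (elements q)))))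
  filter-adjoin (false ∷ γ) (false ∷ q) =
    trans (filterᵇ-map (lookup (true ∷ compl γ)) suc (elements (adjoin γ q)))
          (trans (cong (map suc) (filter-adjoin γ q)) (sym (enum-shift γ (elements q))))

  reject-adjoin : ∀ {n} (γ : Subset n) q →
    filterᵇ (not ∘ lookup (compl γ)) (elements (adjoin γ q)) ≡ elements γ
  reject-adjoin []          []          = refl
  reject-adjoin (true ∷ γ)  q           = cong (zero ∷_)
    (trans (filterᵇ-map (not ∘ lookup (false ∷ compl γ)) suc (elements (adjoin γ q))) (cong (map suc) (reject-adjoin γ q)))
  reject-adjoin (false ∷ γ) (true ∷ q)  =
    trans (filterᵇ-map (not ∘ lookup (true ∷ compl γ)) suc (elements (adjoin γ q))) (cong (map suc) (reject-adjoin γ q))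
  reject-adjoin (false ∷ γ) (false ∷ q) =
    trans (filterᵇ-map (not ∘ lookup (true ∷ compl γ)) suc (elements (adjoin γ q))) (cong (map suc) (reject-adjoin γ q))

-- Determinants with rows indexed by a list of labels, over a commutative ring.
module ListDeterminant {c ℓ} (R : CommutativeRing c ℓ) where
  open import Data.Nat using (ℕ; zero; suc; pred)
  open import Data.Nat.Properties using (suc-injective)
  open import Data.Bool using (Bool; true; false; not; if_then_else_)
  open import Data.Fin using (Fin; zero; suc)
  open import Data.List using (List; []; _∷_; _++_; map; length; filterᵇ)
  open import Data.List.Membership.Propositional using (_∈_)
  open import Data.List.Membership.Propositional.Properties using (∈-++⁺ʳ)
  open import Data.List.Relation.Unary.All using (All; []; _∷_)
  open import Data.List.Relation.Unary.Any using (here; there)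
  open import Data.List.Relation.Binary.Permutation.Propositional as Perm using (_↭_)
  open import Data.Product using (Σ; _×_; _,_)
  open import Function using (_∘_)
  import Relation.Binary.PropositionalEquality as ≡
  open ≡ using (_≡_)
  open CommutativeRing R hiding (zero)
  open import Algebra.Properties.Ring ring
    using (-0#≈0#; -‿involutive; -‿distribˡ-*; -‿distribʳ-*; x[y-z]≈xy-xz; -‿+-comm; ⁻¹-anti-homo‿-)
  open import Algebra.Properties.CommutativeSemigroup +-commutativeSemigroup using (interchange)
  open import Algebra.Properties.CommutativeSemigroup *-commutativeSemigroup using (x∙yz≈y∙xz)
  open import Algebra.Properties.Semiring.Sum semiring using (sum; sum-cong-≋; sum-replicate-zero; *-distribʳ-sum)
  open import Relation.Binary.Reasoning.Setoid setoid

  minus-cong : ∀ {a a′ b b′} → a ≈ a′ → b ≈ b′ → a - b ≈ a′ - b′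
  minus-cong p q = +-cong p (-‿cong q)

  minus-zero : ∀ {a b} → a ≈ 0# → b ≈ 0# → a - b ≈ 0#
  minus-zero p q = trans (minus-cong p q) (-‿inverseʳ 0#)

  minus-minus : ∀ a b d → a - (b - d) ≈ (a - b) + d
  minus-minus a b d = begin
    a - (b - d)     ≈⟨ +-congˡ (-‿+-comm b (- d)) ⟨
    a + (- b - - d) ≈⟨ +-congˡ (+-congˡ (-‿involutive d)) ⟩
    a + (- b + d)   ≈⟨ +-assoc a (- b) d ⟨
    (a - b) + d     ∎

  plus-minus-plus : ∀ a b d e → (a + b) - (d + e) ≈ (a - d) + (b - e)
  plus-minus-plus a b d e = trans (+-congˡ (sym (-‿+-comm d e))) (interchange a b (- d) (- e))

  IsSign : Carrier → Set ℓ
  IsSign s = s * s ≈ 1#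

  sign-1 : IsSign 1#
  sign-1 = *-identityˡ 1#

  sign-neg : ∀ {s} → IsSign s → IsSign (- s)
  sign-neg {s} s² = begin
    - s * - s     ≈⟨ -‿distribˡ-* s (- s) ⟨
    - (s * - s)   ≈⟨ -‿cong (-‿distribʳ-* s s) ⟨
    - - (s * s)   ≈⟨ -‿involutive (s * s) ⟩
    s * s         ≈⟨ s² ⟩
    1#            ∎

  sign-* : ∀ {s t} → IsSign s → IsSign t → IsSign (s * t)
  sign-* {s} {t} s² t² = begin
    (s * t) * (s * t) ≈⟨ *-assoc s t (s * t) ⟩
    s * (t * (s * t)) ≈⟨ *-congˡ (x∙yz≈y∙xz t s t) ⟩
    s * (s * (t * t)) ≈⟨ *-assoc s s (t * t) ⟨
    (s * s) * (t * t) ≈⟨ *-cong s² t² ⟩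
    1# * 1#           ≈⟨ *-identityˡ 1# ⟩
    1#                ∎

  altSign : ℕ → Carrier
  altSign zero    = 1#
  altSign (suc k) = - altSign k

  altSign-sign : ∀ k → IsSign (altSign k)
  altSign-sign zero    = sign-1
  altSign-sign (suc k) = sign-neg (altSign-sign k)

  sum-zero : ∀ {k} {f : Fin k → Carrier} → (∀ l → f l ≈ 0#) → sum f ≈ 0#
  sum-zero {k} e = trans (sum-cong-≋ e) (sum-replicate-zero k)

  sum-neg : ∀ {k} (f : Fin k → Carrier) → sum (λ l → - f l) ≈ - sum f
  sum-neg {zero}  f = sym -0#≈0#
  sum-neg {suc k} f = trans (+-congˡ (sum-neg (f ∘ suc))) (-‿+-comm _ _)

  -- A kernel h assigns a value h x R to a chosen row x and the list R of remaining rows.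
  Kernel : Set → Set c
  Kernel I = I → List I → Carrier

  module _ {I : Set} where

    -- push x h: the kernel h for lists that still contain x in front.
    push : I → Kernel I → Kernel I
    push x h y ys = h y (x ∷ ys)

    -- expand h [x₀,…,xₘ] = Σᵢ (−1)ⁱ h xᵢ [x₀,…,xᵢ₋₁,xᵢ₊₁,…,xₘ]: the alternating sum of a Laplace expansion.
    expand : Kernel I → List I → Carrier
    expand h []       = 0#
    expand h (x ∷ xs) = h x xs - expand (push x h) xs

    expand-cong : ∀ {h h′ : Kernel I} → (∀ a R → h a R ≈ h′ a R) → ∀ rs → expand h rs ≈ expand h′ rs
    expand-cong e []       = refl
    expand-cong e (x ∷ xs) = minus-cong (e x xs) (expand-cong (λ a R → e a (x ∷ R)) xs)

    expand-zero : ∀ {h : Kernel I} → (∀ a R → h a R ≈ 0#) → ∀ rs → expand h rs ≈ 0#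
    expand-zero e []       = refl
    expand-zero e (x ∷ xs) = minus-zero (e x xs) (expand-zero (λ a R → e a (x ∷ R)) xs)

    expand-+ : ∀ (h₁ h₂ : Kernel I) rs →
               expand (λ a R → h₁ a R + h₂ a R) rs ≈ expand h₁ rs + expand h₂ rs
    expand-+ h₁ h₂ []       = sym (+-identityˡ 0#)
    expand-+ h₁ h₂ (x ∷ xs) =
      trans (+-congˡ (-‿cong (expand-+ (push x h₁) (push x h₂) xs))) (plus-minus-plus _ _ _ _)

    expand-neg : ∀ (h : Kernel I) rs → expand (λ a R → - h a R) rs ≈ - expand h rs
    expand-neg h []       = sym -0#≈0#
    expand-neg h (x ∷ xs) = trans (+-congˡ (-‿cong (expand-neg (push x h) xs))) (-‿+-comm _ _)

    expand-− : ∀ (h₁ h₂ : Kernel I) rs →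
               expand (λ a R → h₁ a R - h₂ a R) rs ≈ expand h₁ rs - expand h₂ rs
    expand-− h₁ h₂ rs = trans (expand-+ h₁ (λ a R → - h₂ a R) rs) (+-congˡ (expand-neg h₂ rs))

    expand-* : ∀ k (h : Kernel I) rs → expand (λ a R → k * h a R) rs ≈ k * expand h rs
    expand-* k h []       = sym (zeroʳ k)
    expand-* k h (x ∷ xs) =
      trans (+-congˡ (-‿cong (expand-* k (push x h) xs))) (sym (x[y-z]≈xy-xz k _ _))

    expand-sum : ∀ {k} (g : Fin k → Kernel I) rs →
                 expand (λ a R → sum (λ l → g l a R)) rs ≈ sum (λ l → expand (g l) rs)
    expand-sum {zero}  g rs = expand-zero (λ a R → refl) rs
    expand-sum {suc k} g rs =
      trans (expand-+ (g zero) (λ a R → sum (λ l → g (suc l) a R)) rs) (+-congˡ (expand-sum (g ∘ suc) rs))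

    -- Expanding twice collects, for each pair of positions, the antisymmetrised two-variable kernel.
    pairSum : (I → Kernel I) → List I → Carrier
    pairSum g []       = 0#
    pairSum g (x ∷ xs) = expand (λ b R → g x b R - g b x R) xs + pairSum (λ a → push x (g a)) xs

    expand²≈pairSum : ∀ g rs → expand (λ a R → expand (g a) R) rs ≈ pairSum g rs
    expand²≈pairSum g []       = refl
    expand²≈pairSum g (x ∷ xs) = begin
      expand (g x) xs - expand (λ a R → g a x R - expand (push x (g a)) R) xs
        ≈⟨ +-congˡ (-‿cong (expand-− (λ a R → g a x R) (λ a R → expand (push x (g a)) R) xs)) ⟩
      expand (g x) xs - (expand (λ a R → g a x R) xs - expand (λ a R → expand (push x (g a)) R) xs)
        ≈⟨ +-congˡ (-‿cong (+-congˡ (-‿cong (expand²≈pairSum (λ a → push x (g a)) xs)))) ⟩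
      expand (g x) xs - (expand (λ a R → g a x R) xs - pairSum (λ a → push x (g a)) xs)
        ≈⟨ minus-minus _ _ _ ⟩
      (expand (g x) xs - expand (λ a R → g a x R) xs) + pairSum (λ a → push x (g a)) xs
        ≈⟨ +-congʳ (expand-− (g x) (λ a R → g a x R) xs) ⟨
      pairSum g (x ∷ xs) ∎

    pairSum-cong : ∀ {g g′ : I → Kernel I} → (∀ a b R → g a b R ≈ g′ a b R) → ∀ rs → pairSum g rs ≈ pairSum g′ rs
    pairSum-cong e []       = refl
    pairSum-cong e (x ∷ xs) =
      +-cong (expand-cong (λ b R → minus-cong (e x b R) (e b x R)) xs) (pairSum-cong (λ a b R → e a b (x ∷ R)) xs)

    pairSum-symmetric : ∀ {g : I → Kernel I} → (∀ a b R → g a b R ≈ g b a R) → ∀ rs → pairSum g rs ≈ 0#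
    pairSum-symmetric e []       = refl
    pairSum-symmetric e (x ∷ xs) = trans
      (+-cong (expand-zero (λ b R → trans (+-congʳ (e x b R)) (-‿inverseʳ _)) xs)
              (pairSum-symmetric (λ a b R → e a b (x ∷ R)) xs))
      (+-identityˡ 0#)

    pairSum-flip : ∀ (g : I → Kernel I) rs → pairSum (λ a b → g b a) rs ≈ - pairSum g rs
    pairSum-flip g []       = sym -0#≈0#
    pairSum-flip g (x ∷ xs) = begin
      expand (λ b R → g b x R - g x b R) xs + pairSum (λ a b R → g b a (x ∷ R)) xs
        ≈⟨ +-cong (expand-cong (λ b R → sym (⁻¹-anti-homo‿- (g x b R) (g b x R))) xs)
                  (pairSum-flip (λ a → push x (g a)) xs) ⟩
      expand (λ b R → - (g x b R - g b x R)) xs + - pairSum (λ a → push x (g a)) xs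
        ≈⟨ +-congʳ (expand-neg (λ b R → g x b R - g b x R) xs) ⟩
      - expand (λ b R → g x b R - g b x R) xs + - pairSum (λ a → push x (g a)) xs
        ≈⟨ -‿+-comm _ _ ⟩
      - pairSum g (x ∷ xs) ∎

    -- The determinant of a matrix whose rows are labelled by rs and whose columns are given as
    -- functions on row labels, by Laplace expansion along the first column.
    noColumnsDet : List I → Carrier
    noColumnsDet []      = 1#
    noColumnsDet (_ ∷ _) = 0#

    detL : List I → List (I → Carrier) → Carrier
    detL rs []       = noColumnsDet rs
    detL rs (v ∷ vs) = expand (λ r R → v r * detL R vs) rs

    detL≈pairSum : ∀ x y vs rs → detL rs (x ∷ y ∷ vs) ≈ pairSum (λ a b R → x a * (y b * detL R vs)) rs
    detL≈pairSum x y vs rs = trans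
      (expand-cong (λ r R → sym (expand-* (x r) (λ b R′ → y b * detL R′ vs) R)) rs)
      (expand²≈pairSum (λ a b R → x a * (y b * detL R vs)) rs)

    detL-swap : ∀ x y vs rs → detL rs (x ∷ y ∷ vs) ≈ - detL rs (y ∷ x ∷ vs)
    detL-swap x y vs rs = begin
      detL rs (x ∷ y ∷ vs)                           ≈⟨ detL≈pairSum x y vs rs ⟩
      pairSum (λ a b R → x a * (y b * detL R vs)) rs ≈⟨ pairSum-cong (λ a b R → x∙yz≈y∙xz (x a) (y b) _) rs ⟩
      pairSum (λ a b R → y b * (x a * detL R vs)) rs ≈⟨ pairSum-flip (λ a b R → y a * (x b * detL R vs)) rs ⟩
      - pairSum (λ a b R → y a * (x b * detL R vs)) rs ≈⟨ -‿cong (detL≈pairSum y x vs rs) ⟨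
      - detL rs (y ∷ x ∷ vs)                         ∎

    detL-duplicate : ∀ x vs rs → detL rs (x ∷ x ∷ vs) ≈ 0#
    detL-duplicate x vs rs =
      trans (detL≈pairSum x x vs rs) (pairSum-symmetric (λ a b R → x∙yz≈y∙xz (x a) (x b) _) rs)

    detL-repeated : ∀ {w T} → w ∈ T → ∀ rs → detL rs (w ∷ T) ≈ 0#
    detL-repeated {w} {_ ∷ T} (here ≡.refl) rs = detL-duplicate w T rs
    detL-repeated {w} (there {y} {T} p)  rs = begin
      detL rs (w ∷ y ∷ T)                               ≈⟨ detL-swap w y T rs ⟩
      - expand (λ r R → y r * detL R (w ∷ T)) rs        ≈⟨ -‿cong (expand-zero vanish rs) ⟩
      - 0#                                              ≈⟨ -0#≈0# ⟩
      0#                                                ∎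
      where
      vanish : ∀ r R → y r * detL R (w ∷ T) ≈ 0#
      vanish r R = trans (*-congˡ (detL-repeated p R)) (zeroʳ (y r))

    detL-prep : ∀ s x vs vs′ → (∀ rs → detL rs vs ≈ s * detL rs vs′) →
                ∀ rs → detL rs (x ∷ vs) ≈ s * detL rs (x ∷ vs′)
    detL-prep s x vs vs′ e rs = trans
      (expand-cong (λ r R → trans (*-congˡ (e R)) (x∙yz≈y∙xz (x r) s _)) rs)
      (expand-* s (λ r R → x r * detL R vs′) rs)

    detL-permute : ∀ {vs vs′} → vs ↭ vs′ → Σ Carrier λ s → IsSign s × (∀ rs → detL rs vs ≈ s * detL rs vs′)
    detL-permute Perm.refl = 1# , sign-1 , λ rs → sym (*-identityˡ _)
    detL-permute (Perm.prep {vs} {vs′} x p) with detL-permute p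
    ... | s , s² , e = s , s² , detL-prep s x vs vs′ e
    detL-permute (Perm.swap {vs} {vs′} x y p) with detL-permute p
    ... | s , s² , e = - s , sign-neg s² , λ rs → begin
      detL rs (x ∷ y ∷ vs)          ≈⟨ detL-prep s x (y ∷ vs) (y ∷ vs′) (detL-prep s y vs vs′ e) rs ⟩
      s * detL rs (x ∷ y ∷ vs′)     ≈⟨ *-congˡ (detL-swap x y vs′ rs) ⟩
      s * - detL rs (y ∷ x ∷ vs′)   ≈⟨ -‿distribʳ-* s _ ⟨
      - (s * detL rs (y ∷ x ∷ vs′)) ≈⟨ -‿distribˡ-* s _ ⟩
      - s * detL rs (y ∷ x ∷ vs′)   ∎
    detL-permute (Perm.trans p q) with detL-permute p | detL-permute q
    ... | s , s² , e | t , t² , f = s * t , sign-* s² t² ,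
      λ rs → trans (e rs) (trans (*-congˡ (f rs)) (sym (*-assoc s t _)))

    detL-map-cong : ∀ {Y : Set} (f f′ : Y → I → Carrier) → (∀ y a → f y a ≈ f′ y a) →
                    ∀ L rs → detL rs (map f L) ≈ detL rs (map f′ L)
    detL-map-cong f f′ e []      rs = refl
    detL-map-cong f f′ e (y ∷ L) rs = expand-cong (λ r R → *-cong (e y r) (detL-map-cong f f′ e L R)) rs

    detL-addCombination : ∀ {k} (u u′ : I → Carrier) (coef : Fin k → Carrier) (w : Fin k → I → Carrier) T →
      (∀ a → u′ a ≈ u a + sum (λ l → coef l * w l a)) → (∀ l → w l ∈ T) →
      ∀ rs → detL rs (u′ ∷ T) ≈ detL rs (u ∷ T)
    detL-addCombination u u′ coef w T e w∈T rs = begin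
      expand (λ r R → u′ r * detL R T) rs
        ≈⟨ expand-cong (λ r R → distribute r (detL R T)) rs ⟩
      expand (λ r R → u r * detL R T + sum (λ l → coef l * (w l r * detL R T))) rs
        ≈⟨ expand-+ _ _ rs ⟩
      detL rs (u ∷ T) + expand (λ r R → sum (λ l → coef l * (w l r * detL R T))) rs
        ≈⟨ +-congˡ (expand-sum (λ l r R → coef l * (w l r * detL R T)) rs) ⟩
      detL rs (u ∷ T) + sum (λ l → expand (λ r R → coef l * (w l r * detL R T)) rs)
        ≈⟨ +-congˡ (sum-zero (λ l → trans (expand-* (coef l) _ rs)
                                          (trans (*-congˡ (detL-repeated (w∈T l) rs)) (zeroʳ _)))) ⟩
      detL rs (u ∷ T) + 0#
        ≈⟨ +-identityʳ _ ⟩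
      detL rs (u ∷ T) ∎
      where
      distribute : ∀ r d → u′ r * d ≈ u r * d + sum (λ l → coef l * (w l r * d))
      distribute r d = begin
        u′ r * d                                  ≈⟨ *-congʳ (e r) ⟩
        (u r + sum (λ l → coef l * w l r)) * d     ≈⟨ distribʳ d _ _ ⟩
        u r * d + sum (λ l → coef l * w l r) * d   ≈⟨ +-congˡ (*-distribʳ-sum d (λ l → coef l * w l r)) ⟩
        u r * d + sum (λ l → (coef l * w l r) * d) ≈⟨ +-congˡ (sum-cong-≋ (λ l → *-assoc (coef l) (w l r) d)) ⟩
        u r * d + sum (λ l → coef l * (w l r * d)) ∎

    detL-columnOps : ∀ {Y : Set} {k} (f f′ : Y → I → Carrier) (coef : Y → Fin k → Carrier)
      (w : Fin k → I → Carrier) ws →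
      (∀ y a → f′ y a ≈ f y a + sum (λ l → coef y l * w l a)) → (∀ l → w l ∈ ws) →
      ∀ L rs → detL rs (map f′ L ++ ws) ≈ detL rs (map f L ++ ws)
    detL-columnOps f f′ coef w ws e w∈ws []      rs = refl
    detL-columnOps f f′ coef w ws e w∈ws (y ∷ L) rs = begin
      detL rs (f′ y ∷ map f′ L ++ ws)
        ≈⟨ expand-cong (λ r R → *-congˡ (detL-columnOps f f′ coef w ws e w∈ws L R)) rs ⟩
      detL rs (f′ y ∷ map f L ++ ws)
        ≈⟨ detL-addCombination (f y) (f′ y) (coef y) w (map f L ++ ws) (e y) (λ l → ∈-++⁺ʳ (map f L) (w∈ws l)) rs ⟩
      detL rs (f y ∷ map f L ++ ws) ∎

  module _ {I J : Set} (g : I → J) where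

    expand-map : ∀ (h : Kernel J) rs → expand h (map g rs) ≈ expand (λ a R → h (g a) (map g R)) rs
    expand-map h []       = refl
    expand-map h (x ∷ xs) = minus-cong refl (expand-map (push (g x) h) xs)

    detL-relabel : ∀ vs rs → detL (map g rs) vs ≈ detL rs (map (_∘ g) vs)
    detL-relabel []       []      = refl
    detL-relabel []       (_ ∷ _) = refl
    detL-relabel (v ∷ vs) rs      =
      trans (expand-map (λ r R → v r * detL R vs) rs) (expand-cong (λ a R → *-congˡ (detL-relabel vs R)) rs)

  -- Block triangular determinants whose rows are interleaved: P selects some of the rows.
  module Shuffle {I : Set} (P : I → Bool) where

    selected rejected : List I → List I
    selected = filterᵇ P
    rejected = filterᵇ (not ∘ P)

    -- The sign of the permutation moving the selected rows, in order, in front of the rejected ones.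
    shuffleSign : List I → Carrier
    shuffleSign []       = 1#
    shuffleSign (x ∷ xs) = if P x then shuffleSign xs else altSign (length (selected xs)) * shuffleSign xs

    shuffleSign-sign : ∀ rs → IsSign (shuffleSign rs)
    shuffleSign-sign []       = sign-1
    shuffleSign-sign (x ∷ xs) with P x
    ... | true  = shuffleSign-sign xs
    ... | false = sign-* (altSign-sign (length (selected xs))) (shuffleSign-sign xs)

    module _ {x : I} where

      count-selected : P x ≡ true → ∀ L → length (selected (x ∷ L)) ≡ suc (length (selected L))
      count-selected e L rewrite e = ≡.refl

      count-rejected : P x ≡ false → ∀ L → length (selected (x ∷ L)) ≡ length (selected L)
      count-rejected e L rewrite e = ≡.refl

      unfold-selected : P x ≡ true → ∀ (K : List I → List I → Carrier) L →
        shuffleSign (x ∷ L) * K (selected (x ∷ L)) (rejected (x ∷ L)) ≡ shuffleSign L * K (x ∷ selected L) (rejected L)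
      unfold-selected e K L rewrite e = ≡.refl

      unfold-rejected : P x ≡ false → ∀ (K : List I → List I → Carrier) L →
        shuffleSign (x ∷ L) * K (selected (x ∷ L)) (rejected (x ∷ L))
          ≡ (altSign (length (selected L)) * shuffleSign L) * K (selected L) (x ∷ rejected L)
      unfold-rejected e K L rewrite e = ≡.refl

    private
      factor : ∀ e a b g → e * (a * g) - e * (b * g) ≈ e * ((a - b) * g)
      factor e a b g = begin
        e * (a * g) - e * (b * g) ≈⟨ x[y-z]≈xy-xz e _ _ ⟨
        e * (a * g - b * g)       ≈⟨ *-congˡ (trans (+-congˡ (-‿distribˡ-* b g)) (sym (distribʳ g a (- b)))) ⟩
        e * ((a - b) * g)         ∎

      regroup : ∀ e a E g → e * ((a * E) * g) ≈ (a * e) * (E * g)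
      regroup e a E g = begin
        e * ((a * E) * g) ≈⟨ *-congˡ (*-assoc a E g) ⟩
        e * (a * (E * g)) ≈⟨ *-assoc e a (E * g) ⟨
        (e * a) * (E * g) ≈⟨ *-congʳ (*-comm e a) ⟩
        (a * e) * (E * g) ∎

      altSign-pred : ∀ (H : Kernel I) L → - (altSign (pred (length L)) * expand H L) ≈ altSign (length L) * expand H L
      altSign-pred H []      = trans (-‿cong (zeroʳ _)) (trans -0#≈0# (sym (zeroʳ _)))
      altSign-pred H (_ ∷ _) = -‿distribˡ-* _ _

    VanishesAtRejected : Kernel I → Set ℓ
    VanishesAtRejected h = ∀ a R → P a ≡ false → h a R ≈ 0#

    Factors : (List I → Carrier) → Kernel I → Kernel I → ℕ → Set ℓ
    Factors G h H m = ∀ a R → P a ≡ true → suc (length (selected R)) ≡ m →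
                      h a R ≈ shuffleSign R * (H a (selected R) * G (rejected R))

    factors-selected : ∀ {x} G h H m → P x ≡ true → Factors G h H (suc m) → Factors G (push x h) (push x H) m
    factors-selected {x} G h H m x∈P fac a R a∈P count =
      trans (fac a (x ∷ R) a∈P (≡.trans (≡.cong suc (count-selected x∈P R)) (≡.cong suc count)))
            (reflexive (unfold-selected x∈P (λ S T → H a S * G T) R))

    factors-rejected : ∀ {x} G h H m → P x ≡ false →
      Factors G h H m → Factors (G ∘ (x ∷_)) (push x h) (λ a R → altSign (pred m) * H a R) m
    factors-rejected {x} G h H m x∉P fac a R a∈P count = begin
      h a (x ∷ R)
        ≈⟨ fac a (x ∷ R) a∈P (≡.trans (≡.cong suc (count-rejected x∉P R)) count) ⟩
      shuffleSign (x ∷ R) * (H a (selected (x ∷ R)) * G (rejected (x ∷ R)))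
        ≡⟨ unfold-rejected x∉P (λ S T → H a S * G T) R ⟩
      (altSign (length (selected R)) * shuffleSign R) * (H a (selected R) * G (x ∷ rejected R))
        ≡⟨ ≡.cong (λ l → (altSign l * shuffleSign R) * (H a (selected R) * G (x ∷ rejected R))) (≡.cong pred count) ⟩
      (altSign (pred m) * shuffleSign R) * (H a (selected R) * G (x ∷ rejected R))
        ≈⟨ regroup (shuffleSign R) (altSign (pred m)) (H a (selected R)) (G (x ∷ rejected R)) ⟨
      shuffleSign R * ((altSign (pred m) * H a (selected R)) * G (x ∷ rejected R)) ∎

    expand-shuffle : ∀ (G : List I → Carrier) (h H : Kernel I) rs →
      VanishesAtRejected h → Factors G h H (length (selected rs)) →
      expand h rs ≈ shuffleSign rs * (expand H (selected rs) * G (rejected rs))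
    expand-shuffle G h H []       _     _   = sym (trans (*-identityˡ _) (zeroˡ _))
    expand-shuffle G h H (x ∷ xs) h-rej fac with P x in x∈P
    ... | true = begin
      h x xs - expand (push x h) xs
        ≈⟨ minus-cong (fac x xs x∈P ≡.refl) IH ⟩
      ε * (H x (selected xs) * G (rejected xs)) - ε * (expand (push x H) (selected xs) * G (rejected xs))
        ≈⟨ factor _ _ _ _ ⟩
      ε * ((H x (selected xs) - expand (push x H) (selected xs)) * G (rejected xs)) ∎
      where
      ε = shuffleSign xs
      IH : expand (push x h) xs ≈ ε * (expand (push x H) (selected xs) * G (rejected xs))
      IH = expand-shuffle G (push x h) (push x H) xs (λ a R → h-rej a (x ∷ R)) (factors-selected G h H (length (selected xs)) x∈P fac)
    ... | false = begin
      h x xs - expand (push x h) xs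
        ≈⟨ minus-cong (h-rej x xs x∈P) IH ⟩
      0# - ε * (expand (λ a R → σ * H a R) (selected xs) * g)
        ≈⟨ +-identityˡ _ ⟩
      - (ε * (expand (λ a R → σ * H a R) (selected xs) * g))
        ≈⟨ -‿cong (*-congˡ (*-congʳ (expand-* σ H (selected xs)))) ⟩
      - (ε * ((σ * E) * g))
        ≈⟨ -‿distribʳ-* _ _ ⟩
      ε * - ((σ * E) * g)
        ≈⟨ *-congˡ (-‿distribˡ-* _ _) ⟩
      ε * (- (σ * E) * g)
        ≈⟨ *-congˡ (*-congʳ (altSign-pred H (selected xs))) ⟩
      ε * ((altSign (length (selected xs)) * E) * g)
        ≈⟨ regroup _ _ _ _ ⟩
      (altSign (length (selected xs)) * ε) * (E * g) ∎
      where
      ε = shuffleSign xs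
      σ = altSign (pred (length (selected xs)))
      E = expand H (selected xs)
      g = G (x ∷ rejected xs)
      IH : expand (push x h) xs ≈ ε * (expand (λ a R → σ * H a R) (selected xs) * g)
      IH = expand-shuffle (G ∘ (x ∷_)) (push x h) (λ a R → σ * H a R) xs
             (λ a R → h-rej a (x ∷ R)) (factors-rejected G h H (length (selected xs)) x∈P fac)

    shuffle-none : ∀ rs → length (selected rs) ≡ 0 →
                   (selected rs ≡ []) × (rejected rs ≡ rs) × (shuffleSign rs ≈ 1#)
    shuffle-none []       _ = ≡.refl , ≡.refl , refl
    shuffle-none (x ∷ xs) c with P x
    shuffle-none (x ∷ xs) () | true
    ... | false with shuffle-none xs c
    ... | sel , rej , sign = sel , ≡.cong (x ∷_) rej ,
      trans (*-congʳ (reflexive (≡.cong altSign c))) (trans (*-identityˡ _) sign)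

    detL-block : ∀ (us ws : List (I → Carrier)) → All (λ u → ∀ a → P a ≡ false → u a ≈ 0#) us →
      ∀ rs → length (selected rs) ≡ length us →
      detL rs (us ++ ws) ≈ shuffleSign rs * (detL (selected rs) us * detL (rejected rs) ws)
    detL-block [] ws _ rs c with shuffle-none rs c
    ... | sel , rej , sign = begin
      detL rs ws                                              ≡⟨ ≡.cong (λ L → detL L ws) (≡.sym rej) ⟩
      detL (rejected rs) ws                                   ≈⟨ *-identityˡ _ ⟨
      1# * detL (rejected rs) ws                              ≈⟨ *-congʳ (sym sign) ⟩
      shuffleSign rs * detL (rejected rs) ws                  ≈⟨ *-congˡ (*-identityˡ _) ⟨
      shuffleSign rs * (1# * detL (rejected rs) ws)           ≡⟨ ≡.cong (λ L → shuffleSign rs * (detL L [] * detL (rejected rs) ws)) (≡.sym sel) ⟩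
      shuffleSign rs * (detL (selected rs) [] * detL (rejected rs) ws) ∎
    detL-block (u ∷ us) ws (u-rej ∷ us-rej) rs c =
      expand-shuffle (λ L → detL L ws) (λ r R → u r * detL R (us ++ ws)) (λ a L → u a * detL L us) rs
        (λ a R e → trans (*-congʳ (u-rej a e)) (zeroˡ _))
        (λ a R e c′ → trans (*-congˡ (detL-block us ws us-rej R (suc-injective (≡.trans c′ c))))
                            (rearrange (u a) (shuffleSign R) (detL (selected R) us) (detL (rejected R) ws)))
      where
      rearrange : ∀ u e d g → u * (e * (d * g)) ≈ e * ((u * d) * g)
      rearrange u e d g = trans (x∙yz≈y∙xz u e _) (*-congˡ (sym (*-assoc u d g)))

module SchurMinors {c ℓ} (F : Field c ℓ) where
  open Subsets
  open import Defs using (Field; Subset; card; compl; elems; Matrix; sumF; sgn; toN; det; _·_; identity;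
                          sub; prin; minor; _≈M_; schur; Nonsingular; QPRAt; A; N)
  open Field F hiding (zero)
  open ListDeterminant commutativeRing
  open import Algebra.Properties.Ring ring using (-0#≈0#; -‿distribˡ-*)
  open import Algebra.Properties.Semiring.Sum semiring
    using (sum; sum-cong-≋; ∑-comm; *-distribˡ-sum; *-distribʳ-sum)
  open import Relation.Binary.Reasoning.Setoid setoid
  open import Data.Nat using (ℕ; zero; suc) renaming (_+_ to _+ℕ_)
  open import Data.Fin using (Fin; zero; suc; punchIn; cast)
  open import Data.Fin.Properties using (cast-is-id)
  open import Data.List using (List; []; _∷_; _++_; map; tabulate; length)
  open import Data.List.Properties using (map-tabulate; tabulate-cong; map-++; map-∘; length-map)
  open import Data.Product using (Σ; _×_; _,_)
  open import Data.Bool using (false)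
  open import Data.Vec using (lookup)
  open import Data.List.Membership.Propositional using (_∈_)
  open import Data.List.Membership.Propositional.Properties using (∈-map⁺; ∈-tabulate⁺)
  open import Data.List.Relation.Unary.All using (All; universal)
  open import Data.List.Relation.Unary.All.Properties using () renaming (map⁺ to All-map⁺)
  open import Data.List.Relation.Binary.Permutation.Propositional.Properties using () renaming (map⁺ to ↭-map⁺)
  open import Relation.Nullary using (¬_)
  open import Function using (_∘_)
  import Relation.Binary.PropositionalEquality as ≡
  open ≡ using (_≡_)

  -- The determinant and matrix product of Defs use their own sums and signs;
  -- these agree with the library sum and with altSign.
  sumF≡sum : ∀ {k} (f : Fin k → Carrier) → sumF F f ≡ sum f
  sumF≡sum {zero}  f = ≡.refl
  sumF≡sum {suc k} f = ≡.cong (f zero +_) (sumF≡sum (f ∘ suc))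

  sumF-cong : ∀ {k} {f g : Fin k → Carrier} → (∀ l → f l ≈ g l) → sumF F f ≈ sumF F g
  sumF-cong {zero}  e = refl
  sumF-cong {suc k} e = +-cong (e zero) (sumF-cong (e ∘ suc))

  sgn≡altSign : ∀ k → sgn F k ≡ altSign k
  sgn≡altSign zero    = ≡.refl
  sgn≡altSign (suc k) = ≡.cong -_ (sgn≡altSign k)

  module _ {I : Set} where

    expand-tabulate : ∀ m (h : Kernel I) (r : Fin (suc m) → I) →
      expand h (tabulate r) ≈ sum (λ i → altSign (toN F i) * h (r i) (tabulate (r ∘ punchIn i)))
    expand-tabulate zero    h r = begin
      h (r zero) [] - 0#         ≈⟨ +-congˡ -0#≈0# ⟩
      h (r zero) [] + 0#         ≈⟨ +-congʳ (*-identityˡ _) ⟨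
      1# * h (r zero) [] + 0#    ∎
    expand-tabulate (suc m) h r = begin
      h (r zero) (tabulate (r ∘ suc)) - expand (push (r zero) h) (tabulate (r ∘ suc))
        ≈⟨ minus-cong (sym (*-identityˡ _)) (expand-tabulate m (push (r zero) h) (r ∘ suc)) ⟩
      1# * h (r zero) (tabulate (r ∘ suc)) - sum (λ i → altSign (toN F i) * t i)
        ≈⟨ +-congˡ (sum-neg (λ i → altSign (toN F i) * t i)) ⟨
      1# * h (r zero) (tabulate (r ∘ suc)) + sum (λ i → - (altSign (toN F i) * t i))
        ≈⟨ +-congˡ (sum-cong-≋ (λ i → -‿distribˡ-* (altSign (toN F i)) (t i))) ⟩
      sum (λ i → altSign (toN F i) * h (r i) (tabulate (r ∘ punchIn i))) ∎
      where
      t : Fin (suc m) → Carrier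
      t i = h (r (suc i)) (r zero ∷ tabulate (r ∘ suc ∘ punchIn i))

    det≈detL : ∀ m (r : Fin m → I) (v : Fin m → I → Carrier) →
               det F (λ i j → v j (r i)) ≈ detL (tabulate r) (tabulate v)
    det≈detL zero    r v = refl
    det≈detL (suc m) r v = begin
      sumF F (λ i → sgn F (toN F i) * (v zero (r i) * minorAt i))
        ≡⟨ sumF≡sum (λ i → sgn F (toN F i) * (v zero (r i) * minorAt i)) ⟩
      sum (λ i → sgn F (toN F i) * (v zero (r i) * minorAt i))
        ≈⟨ sum-cong-≋ (λ i → *-cong (reflexive (sgn≡altSign (toN F i)))
                                    (*-congˡ {v zero (r i)} (det≈detL m (r ∘ punchIn i) (v ∘ suc)))) ⟩
      sum (λ i → altSign (toN F i) * (v zero (r i) * detL (tabulate (r ∘ punchIn i)) (tabulate (v ∘ suc))))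
        ≈⟨ expand-tabulate m (λ x R → v zero x * detL R (tabulate (v ∘ suc))) r ⟨
      detL (tabulate r) (tabulate v) ∎
      where
      minorAt : Fin (suc m) → Carrier
      minorAt i = det F (λ a b → v (suc b) (r (punchIn i a)))

  ·-assoc : ∀ {a b d e} (M : Matrix F a b) (P : Matrix F b d) (Q : Matrix F d e) i j →
            _·_ F (_·_ F M P) Q i j ≈ _·_ F M (_·_ F P Q) i j
  ·-assoc M P Q i j = begin
    sumF F (λ m → sumF F (λ l → M i l * P l m) * Q m j)
      ≡⟨ sumF≡sum (λ m → sumF F (λ l → M i l * P l m) * Q m j) ⟩
    sum (λ m → sumF F (λ l → M i l * P l m) * Q m j)
      ≈⟨ sum-cong-≋ (λ m → *-congʳ (reflexive (sumF≡sum (λ l → M i l * P l m)))) ⟩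
    sum (λ m → sum (λ l → M i l * P l m) * Q m j)
      ≈⟨ sum-cong-≋ (λ m → *-distribʳ-sum (Q m j) (λ l → M i l * P l m)) ⟩
    sum (λ m → sum (λ l → (M i l * P l m) * Q m j))
      ≈⟨ ∑-comm (λ l m → (M i l * P l m) * Q m j) ⟨
    sum (λ l → sum (λ m → (M i l * P l m) * Q m j))
      ≈⟨ sum-cong-≋ (λ l → sum-cong-≋ (λ m → *-assoc (M i l) (P l m) (Q m j))) ⟩
    sum (λ l → sum (λ m → M i l * (P l m * Q m j)))
      ≈⟨ sum-cong-≋ (λ l → *-distribˡ-sum (M i l) (λ m → P l m * Q m j)) ⟨
    sum (λ l → M i l * sum (λ m → P l m * Q m j))
      ≈⟨ sum-cong-≋ (λ l → *-congˡ (reflexive (sumF≡sum (λ m → P l m * Q m j)))) ⟨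
    sum (λ l → M i l * sumF F (λ m → P l m * Q m j))
      ≡⟨ sumF≡sum (λ l → M i l * sumF F (λ m → P l m * Q m j)) ⟨
    sumF F (λ l → M i l * sumF F (λ m → P l m * Q m j)) ∎

  identity-select : ∀ {k} (g : Fin k) (v : Fin k → Carrier) → sumF F (λ m → identity F g m * v m) ≈ v g
  identity-select {suc k} zero v = begin
    1# * v zero + sumF F (λ m → 0# * v (suc m)) ≈⟨ +-cong (*-identityˡ _) (reflexive (sumF≡sum (λ m → 0# * v (suc m)))) ⟩
    v zero + sum (λ m → 0# * v (suc m))         ≈⟨ +-congˡ (sum-zero (λ m → zeroˡ (v (suc m)))) ⟩
    v zero + 0#                                 ≈⟨ +-identityʳ _ ⟩
    v zero                                      ∎
  identity-select {suc k} (suc g) v =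
    trans (+-cong (zeroˡ _) (identity-select g (v ∘ suc))) (+-identityˡ _)

  tabulate-cast : ∀ {T : Set} {a b} (e : a ≡ b) (f : Fin a → T) → tabulate (f ∘ cast (≡.sym e)) ≡ tabulate f
  tabulate-cast ≡.refl f = tabulate-cong (λ i → ≡.cong f (cast-is-id ≡.refl i))

  column : ∀ {n} → Matrix F n n → Fin n → Fin n → Carrier
  column M y x = M x y

  detSub≈detL : ∀ {n} (M : Matrix F n n) m (r c′ : Fin m → Fin n) →
                det F (λ i j → M (r i) (c′ j)) ≈ detL (tabulate r) (map (column M) (tabulate c′))
  detSub≈detL M m r c′ =
    trans (det≈detL m r (column M ∘ c′)) (reflexive (≡.cong (detL (tabulate r)) (≡.sym (map-tabulate c′ (column M)))))

  minor≈detL : ∀ {n} (M : Matrix F n n) m α β (eα : card α ≡ m) (eβ : card β ≡ m) →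
               minor F M m α β eα eβ ≈ detL (elements α) (map (column M) (elements β))
  minor≈detL M m α β eα eβ = trans
    (detSub≈detL M m (elems α ∘ cast (≡.sym eα)) (elems β ∘ cast (≡.sym eβ)))
    (reflexive (≡.cong₂ (λ rs cs → detL rs (map (column M) cs))
      (≡.trans (tabulate-cast eα (elems α)) (≡.sym (elements≡tabulate α)))
      (≡.trans (tabulate-cast eβ (elems β)) (≡.sym (elements≡tabulate β)))))

  prin≈detL : ∀ {n} (M : Matrix F n n) γ → det F (prin F M γ) ≈ detL (elements γ) (map (column M) (elements γ))
  prin≈detL M γ = trans (detSub≈detL M (card γ) (elems γ) (elems γ))
    (reflexive (≡.cong (λ rs → detL rs (map (column M) rs)) (≡.sym (elements≡tabulate γ))))

  factor-zero⇒zero : ∀ {b u c d} → b ≈ u * (c * d) → c ≈ 0# → b ≈ 0#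
  factor-zero⇒zero {b} {u} {c} {d} b≈ucd c≈0 = begin
    b           ≈⟨ b≈ucd ⟩
    u * (c * d) ≈⟨ *-congˡ (*-congʳ c≈0) ⟩
    u * (0# * d) ≈⟨ *-congˡ (zeroˡ d) ⟩
    u * 0#      ≈⟨ zeroʳ u ⟩
    0#          ∎

  zero⇒factor-zero : ∀ {b u c d} → IsSign u → ¬ (d ≈ 0#) → b ≈ u * (c * d) → b ≈ 0# → c ≈ 0#
  zero⇒factor-zero {b} {u} {c} {d} u² d≉0 b≈ucd b≈0 with inverse d d≉0
  ... | d⁻¹ , dd⁻¹≈1 = begin
    c              ≈⟨ *-identityʳ c ⟨
    c * 1#         ≈⟨ *-congˡ dd⁻¹≈1 ⟨
    c * (d * d⁻¹)  ≈⟨ *-assoc c d d⁻¹ ⟨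
    (c * d) * d⁻¹  ≈⟨ *-congʳ cd≈0 ⟩
    0# * d⁻¹       ≈⟨ zeroˡ d⁻¹ ⟩
    0#             ∎
    where
    cd≈0 : c * d ≈ 0#
    cd≈0 = begin
      c * d             ≈⟨ *-identityˡ _ ⟨
      1# * (c * d)       ≈⟨ *-congʳ u² ⟨
      (u * u) * (c * d)  ≈⟨ *-assoc u u _ ⟩
      u * (u * (c * d))  ≈⟨ *-congˡ b≈ucd ⟨
      u * b              ≈⟨ *-congˡ b≈0 ⟩
      u * 0#             ≈⟨ zeroʳ u ⟩
      0#                 ∎

  module Schur {n} (B : Matrix F n n) (γ : Subset n) (X : Matrix F (card γ) (card γ))
               (B[γ]X≈I : _≈M_ F (_·_ F (prin F B γ) X) (identity F)) where

    private
      k  = card γ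
      γ̄  = compl γ
      eγ = elems γ
      eγ̄ = elems γ̄

    C : Matrix F (card γ̄) (card γ̄)
    C = schur F B γ X

    -- Y = X·B[γ,γ̄] holds the coefficients of the column operation that clears the rows of γ.
    Y : Matrix F k (card γ̄)
    Y = _·_ F X (sub F B γ γ̄)

    reducedColumn : Fin (card γ̄) → Fin n → Carrier
    reducedColumn b x = column B (eγ̄ b) x + sum (λ l → - Y l b * column B (eγ l) x)

    reducedColumn≈ : ∀ b x → reducedColumn b x ≈ B x (eγ̄ b) - sumF F (λ l → B x (eγ l) * Y l b)
    reducedColumn≈ b x = +-congˡ (begin
      sum (λ l → - Y l b * B x (eγ l))   ≈⟨ sum-cong-≋ (λ l → trans (sym (-‿distribˡ-* (Y l b) (B x (eγ l))))
                                                           (-‿cong (*-comm (Y l b) (B x (eγ l))))) ⟩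
      sum (λ l → - (B x (eγ l) * Y l b)) ≈⟨ sum-neg (λ l → B x (eγ l) * Y l b) ⟩
      - sum (λ l → B x (eγ l) * Y l b)   ≡⟨ ≡.cong -_ (sumF≡sum (λ l → B x (eγ l) * Y l b)) ⟨
      - sumF F (λ l → B x (eγ l) * Y l b) ∎)

    -- The reduced columns vanish on the rows of γ, because B[γ]·X = I …
    reducedColumn-γ : ∀ b g → reducedColumn b (eγ g) ≈ 0#
    reducedColumn-γ b g = begin
      reducedColumn b (eγ g)                                          ≈⟨ reducedColumn≈ b (eγ g) ⟩
      B (eγ g) (eγ̄ b) - _·_ F (prin F B γ) Y g b                      ≈⟨ +-congˡ (-‿cong (·-assoc (prin F B γ) X S g b)) ⟨
      B (eγ g) (eγ̄ b) - _·_ F (_·_ F (prin F B γ) X) S g b            ≈⟨ +-congˡ (-‿cong (sumF-cong (λ m → *-congʳ (B[γ]X≈I g m)))) ⟩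
      B (eγ g) (eγ̄ b) - sumF F (λ m → identity F g m * S m b)         ≈⟨ +-congˡ (-‿cong (identity-select g (λ m → S m b))) ⟩
      B (eγ g) (eγ̄ b) - B (eγ g) (eγ̄ b)                               ≈⟨ -‿inverseʳ _ ⟩
      0#                                                              ∎
      where S = sub F B γ γ̄

    reducedColumn-γ̄ : ∀ b a → reducedColumn b (eγ̄ a) ≈ C a b
    reducedColumn-γ̄ b a = trans (reducedColumn≈ b (eγ̄ a))
      (+-congˡ (-‿cong (sym (·-assoc (sub F B γ̄ γ) X (sub F B γ γ̄) a b))))

    open Shuffle (lookup γ̄)

    γColumns : List (Fin n → Carrier)
    γColumns = map (column B) (elements γ)

    γColumn∈ : ∀ l → column B (eγ l) ∈ γColumns
    γColumn∈ l = ∈-map⁺ (column B) (≡.subst (eγ l ∈_) (≡.sym (elements≡tabulate γ)) (∈-tabulate⁺ l))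

    reducedColumns-vanish : ∀ L → All (λ u → ∀ a → lookup γ̄ a ≡ false → u a ≈ 0#) (map reducedColumn L)
    reducedColumns-vanish L = All-map⁺ (universal vanish L)
      where
      vanish : ∀ b a → lookup γ̄ a ≡ false → reducedColumn b a ≈ 0#
      vanish b a a∉γ̄ with ∉compl⇒∈ γ a a∉γ̄
      ... | g , ≡.refl = reducedColumn-γ b g

    -- In a minor B[α ∪ γ, β ∪ γ] with reduced β-columns, the rows selected by γ̄ are those of α,
    -- and the two diagonal blocks are C[α,β] and B[γ].
    block-sizes : ∀ j α β → card α ≡ j → card β ≡ j →
                  length (selected (elements (adjoin γ α))) ≡ length (map reducedColumn (elements β))
    block-sizes j α β eα eβ = ≡.trans selected-length (≡.sym columns-length)
      where
      selected-length : length (selected (elements (adjoin γ α))) ≡ j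
      selected-length = ≡.trans (≡.cong length (filter-adjoin γ α))
        (≡.trans (length-map eγ̄ (elements α)) (≡.trans (length-elements α) eα))
      columns-length : length (map reducedColumn (elements β)) ≡ j
      columns-length = ≡.trans (length-map reducedColumn (elements β)) (≡.trans (length-elements β) eβ)

    schur-block : ∀ j α β (eα : card α ≡ j) (eβ : card β ≡ j) →
      detL (selected (elements (adjoin γ α))) (map reducedColumn (elements β)) ≈ minor F C j α β eα eβ
    schur-block j α β eα eβ = begin
      detL (selected (elements (adjoin γ α))) (map reducedColumn (elements β))
        ≡⟨ ≡.cong (λ rs → detL rs (map reducedColumn (elements β))) (filter-adjoin γ α) ⟩
      detL (map eγ̄ (elements α)) (map reducedColumn (elements β))
        ≈⟨ detL-relabel eγ̄ (map reducedColumn (elements β)) (elements α) ⟩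
      detL (elements α) (map (_∘ eγ̄) (map reducedColumn (elements β)))
        ≡⟨ ≡.cong (detL (elements α)) (≡.sym (map-∘ (elements β))) ⟩
      detL (elements α) (map (λ b → reducedColumn b ∘ eγ̄) (elements β))
        ≈⟨ detL-map-cong (λ b → reducedColumn b ∘ eγ̄) (column C) reducedColumn-γ̄ (elements β) (elements α) ⟩
      detL (elements α) (map (column C) (elements β))
        ≈⟨ minor≈detL C j α β eα eβ ⟨
      minor F C j α β eα eβ ∎

    γ-block : ∀ α → detL (rejected (elements (adjoin γ α))) γColumns ≈ det F (prin F B γ)
    γ-block α = trans (reflexive (≡.cong (λ rs → detL rs γColumns) (reject-adjoin γ α))) (sym (prin≈detL B γ))

    minor-adjoin : ∀ j α β (eα : card α ≡ j) (eβ : card β ≡ j) →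
      Σ Carrier λ u → IsSign u ×
        (minor F B (j +ℕ k) (adjoin γ α) (adjoin γ β) (adjoin-card γ α eα) (adjoin-card γ β eβ)
           ≈ u * (minor F C j α β eα eβ * det F (prin F B γ)))
    minor-adjoin j α β eα eβ with detL-permute (↭-map⁺ (column B) (elements-adjoin-↭ γ β))
    ... | s , s² , permute = s * shuffleSign rows , sign-* s² (shuffleSign-sign rows) , (begin
      minor F B (j +ℕ k) (adjoin γ α) (adjoin γ β) (adjoin-card γ α eα) (adjoin-card γ β eβ)
        ≈⟨ minor≈detL B (j +ℕ k) (adjoin γ α) (adjoin γ β) (adjoin-card γ α eα) (adjoin-card γ β eβ) ⟩
      detL rows (map (column B) (elements (adjoin γ β)))
        ≈⟨ permute rows ⟩
      s * detL rows (map (column B) (map eγ̄ (elements β) ++ elements γ))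
        ≡⟨ ≡.cong (λ cs → s * detL rows cs) split ⟩
      s * detL rows (map (column B ∘ eγ̄) (elements β) ++ γColumns)
        ≈⟨ *-congˡ (detL-columnOps (column B ∘ eγ̄) reducedColumn (λ b l → - Y l b) (column B ∘ eγ)
                                   γColumns (λ b x → refl) γColumn∈ (elements β) rows) ⟨
      s * detL rows (map reducedColumn (elements β) ++ γColumns)
        ≈⟨ *-congˡ (detL-block (map reducedColumn (elements β)) γColumns
                               (reducedColumns-vanish (elements β)) rows (block-sizes j α β eα eβ)) ⟩
      s * (shuffleSign rows * (detL (selected rows) (map reducedColumn (elements β))
                                 * detL (rejected rows) γColumns))
        ≈⟨ *-congˡ (*-congˡ (*-cong (schur-block j α β eα eβ) (γ-block α))) ⟩
      s * (shuffleSign rows * (minor F C j α β eα eβ * det F (prin F B γ)))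
        ≈⟨ *-assoc _ _ _ ⟨
      (s * shuffleSign rows) * (minor F C j α β eα eβ * det F (prin F B γ)) ∎)
      where
      rows : List (Fin n)
      rows = elements (adjoin γ α)

      split : map (column B) (map eγ̄ (elements β) ++ elements γ) ≡ map (column B ∘ eγ̄) (elements β) ++ γColumns
      split = ≡.trans (map-++ (column B) (map eγ̄ (elements β)) (elements γ))
                      (≡.cong (_++ γColumns) (≡.sym (map-∘ (elements β))))

    allNonzero-descends : ∀ j → QPRAt F B (j +ℕ k) A → QPRAt F C j A
    allNonzero-descends j B-nonzero α β eα eβ αβ-qp C-minor≈0 with minor-adjoin j α β eα eβ
    ... | _ , _ , formula = B-nonzero (adjoin γ α) (adjoin γ β) (adjoin-card γ α eα) (adjoin-card γ β eβ)
                              (quasiPrincipal-adjoin γ α β j αβ-qp) (factor-zero⇒zero formula C-minor≈0)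

    allZero-descends : Nonsingular F (prin F B γ) → ∀ j → QPRAt F B (j +ℕ k) N → QPRAt F C j N
    allZero-descends B[γ]≉0 j B-zero α β eα eβ αβ-qp with minor-adjoin j α β eα eβ
    ... | _ , u² , formula = zero⇒factor-zero u² B[γ]≉0 formula
                               (B-zero (adjoin γ α) (adjoin γ β) (adjoin-card γ α eα) (adjoin-card γ β eβ)
                                       (quasiPrincipal-adjoin γ α β j αβ-qp))

open import Defs
open import Level using (Level)
open import Data.Nat using (ℕ; _+_; _≤_)
open import Data.Sum using (_⊎_; inj₁; inj₂)
open import Data.Product using (_,_)
open import Relation.Binary.PropositionalEquality using (_≡_; refl)

-- For L ∈ {A, N}, q_{j+|γ|} = L forces q′_j = L; only B[γ]·X = I is used of the inverse.
mainTheorem2 : ∀ {c ℓ : Level} (F : Field c ℓ) (n : ℕ) (B : Matrix F n n) →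
    Symmetric F B →
    (γ : Subset n) → Nonsingular F (prin F B γ) → RankAtLeast F B (card γ) →
    (X : Matrix F (card γ) (card γ)) → IsInverse F (prin F B γ) X →
    (j : ℕ) → 1 ≤ j → j ≤ card (compl γ) →
    (L : QPRLetter) → (L ≡ A ⊎ L ≡ N) →
    QPRAt F B (j + card γ) L → QPRAt F (schur F B γ X) j L
mainTheorem2 F _ B _ γ _       _ X (B[γ]X≈I , _) j _ _ .A (inj₁ refl) =
  SchurMinors.Schur.allNonzero-descends F B γ X B[γ]X≈I j
mainTheorem2 F _ B _ γ B[γ]≉0 _ X (B[γ]X≈I , _) j _ _ .N (inj₂ refl) =
  SchurMinors.Schur.allZero-descends F B γ X B[γ]X≈I B[γ]≉0 j
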